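{- Let $\Sigma$ be a polarised nested sequent that has a proof in the calculus $\mathsf{NIKm}$. Then the flat bi-nested sequent $\mathrm{fl}(\Sigma)$ has a proof in the calculus $\mathbf{C}_{\mathbf{IK}}$.
   Context: Formulas: $A ::= p \mid \bot \mid \top \mid A\wedge A\mid A\vee A\mid A\supset A\mid \Box A\mid \Diamond A$, $p$ atomic. Polarised nested sequents: a polarised nested sequent is a finite multiset whose elements are input formulas $A^{\bullet}$, output formulas $A^{\circ}$ ($A$ a formula) and blocks $[\Sigma']$ with $\Sigma'$ a polarised nested sequent (the empty multiset included). A polarised context $\Sigma\{\ \}$ is a polarised nested sequent with one hole in the place of an element of some (possibly nested) multiset; $\Sigma\{\Pi\}$ is obtained by filling the hole with the polarised nested sequent $\Pi$ (its elements are added to the multiset containing the hole). $\Sigma^{\downarrow}\{\ \}$ denotes $\Sigma\{\ \}$ with all output formulas (at all depths) removed. Rules of $\mathsf{NIKm}$ (premises / conclusion): axioms $\Sigma\{\bot^{\bullet}\}$ and $\Sigma\{p^{\bullet},p^{\circ}\}$; $\Sigma\{A^{\bullet},B^{\bullet}\}$ / $\Sigma\{(A\wedge B)^{\bullet}\}$; $\Sigma\{A^{\circ}\}$ and $\Sigma\{B^{\circ}\}$ / $\Sigma\{(A\wedge B)^{\circ}\}$; $\Sigma\{A^{\bullet}\}$ and $\Sigma\{B^{\bullet}\}$ / $\Sigma\{(A\vee B)^{\bullet}\}$; $\Sigma\{A^{\circ},B^{\circ}\}$ / $\Sigma\{(A\vee B)^{\circ}\}$; $\Sigma\{A^{\circ}\}$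 and $\Sigma\{B^{\bullet}\}$ / $\Sigma\{(A\supset B)^{\bullet}\}$; $\Sigma^{\downarrow}\{A^{\bullet},B^{\circ}\}$ / $\Sigma\{(A\supset B)^{\circ}\}$; $\Sigma\{[\Delta,A^{\bullet}]\}$ / $\Sigma\{(\Box A)^{\bullet},[\Delta]\}$; $\Sigma^{\downarrow}\{[A^{\circ}]\}$ / $\Sigma\{(\Box A)^{\circ}\}$; $\Sigma\{[A^{\bullet}]\}$ / $\Sigma\{(\Diamond A)^{\bullet}\}$; $\Sigma\{[\Delta,A^{\circ}]\}$ / $\Sigma\{(\Diamond A)^{\circ},[\Delta]\}$; $\Sigma\{A^{\bullet},A^{\bullet}\}$ / $\Sigma\{A^{\bullet}\}$; $\Sigma\{A^{\circ},A^{\circ}\}$ / $\Sigma\{A^{\circ}\}$. A proof is a finite tree built from these rules whose leaves are axioms. Flat translation: for $\Sigma=A_1^{\bullet},\dots,A_k^{\bullet},B_1^{\circ},\dots,B_h^{\circ},[\Sigma_1],\dots,[\Sigma_n]$, set $\mathrm{fl}(\Sigma)= A_1,\dots,A_k\Rightarrow B_1,\dots,B_h,[\mathrm{fl}(\Sigma_1)],\dots,[\mathrm{fl}(\Sigma_n)]$. Bi-nested sequents: $\Rightarrow$ is one; if $\Gamma,\Delta'$ are finite multisets of formulas and $S_i,T_j$ bi-nested sequents, $\Gamma\Rightarrow\Delta',\langle S_1\rangle,\dots,\langle S_m\rangle,[T_1],\dots,[T_n]$ is one ($\langle\cdot\rangle$ implication blocks, $[\cdot]$ modal blocks). Contexts: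 $\{\ \}$; and $\Gamma\Rightarrow\Delta,\langle G'\{\ \}\rangle$, $\Gamma\Rightarrow\Delta,[G'\{\ \}]$ for $G'$ a context; $G\{S\}$ fills the hole with sequent $S$. Local positive part: if $\Delta=\Delta_0,[\Lambda_1\Rightarrow\Theta_1],\dots,[\Lambda_k\Rightarrow\Theta_k]$ with $\Delta_0$ free of modal blocks, $\Delta^*=[\Lambda_1\Rightarrow\Theta_1^*],\dots,[\Lambda_k\Rightarrow\Theta_k^*]$. Rules of $\mathbf{C}_{\mathbf{IK}}$ (premises / conclusion): axioms $G\{\Gamma,\bot\Rightarrow\Delta\}$, $G\{\Gamma\Rightarrow\top,\Delta\}$, $G\{\Gamma,p\Rightarrow\Delta,p\}$; $G\{A,B,\Gamma\Rightarrow\Delta\}$ / $G\{A\wedge B,\Gamma\Rightarrow\Delta\}$; $G\{\Gamma\Rightarrow\Delta,A\}$ and $G\{\Gamma\Rightarrow\Delta,B\}$ / $G\{\Gamma\Rightarrow\Delta,A\wedge B\}$; $G\{\Gamma,A\Rightarrow\Delta\}$ and $G\{\Gamma,B\Rightarrow\Delta\}$ / $G\{\Gamma,A\vee B\Rightarrow\Delta\}$; $G\{\Gamma\Rightarrow\Delta,A,B\}$ / $G\{\Gamma\Rightarrow\Delta,A\vee B\}$; $G\{\Gamma,A\supset B\Rightarrow A,\Delta\}$ and $G\{\Gamma,B\Rightarrow\Delta\}$ / $G\{\Gamma,A\supset B\Rightarrow\Delta\}$; $G\{\Gamma\Rightarrow\Delta,\langle A\Rightarrow B\rangle\}$ / $G\{\Gamma\Rightarrow\Delta,A\supset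 B\}$; $G\{\Gamma,\Box A\Rightarrow\Delta,[\Sigma,A\Rightarrow\Pi]\}$ / $G\{\Gamma,\Box A\Rightarrow\Delta,[\Sigma\Rightarrow\Pi]\}$; $G\{\Gamma\Rightarrow\Delta,\langle\ \Rightarrow[\ \Rightarrow A]\rangle\}$ / $G\{\Gamma\Rightarrow\Delta,\Box A\}$; $G\{\Gamma\Rightarrow\Delta,[A\Rightarrow\ ]\}$ / $G\{\Gamma,\Diamond A\Rightarrow\Delta\}$; $G\{\Gamma\Rightarrow\Delta,\Diamond A,[\Sigma\Rightarrow\Pi,A]\}$ / $G\{\Gamma\Rightarrow\Delta,\Diamond A,[\Sigma\Rightarrow\Pi]\}$; (trans) $G\{\Gamma,\Gamma'\Rightarrow\Delta,\langle\Gamma',\Sigma\Rightarrow\Pi\rangle\}$ / $G\{\Gamma,\Gamma'\Rightarrow\Delta,\langle\Sigma\Rightarrow\Pi\rangle\}$; $(\mathrm{inter}_{fc})$ $G\{\Gamma\Rightarrow\Delta,\langle\Sigma\Rightarrow\Pi,[\Lambda\Rightarrow\Theta^*]\rangle,[\Lambda\Rightarrow\Theta]\}$ / $G\{\Gamma\Rightarrow\Delta,\langle\Sigma\Rightarrow\Pi\rangle,[\Lambda\Rightarrow\Theta]\}$; $(\mathrm{inter}_{bc})$ $G\{\Gamma\Rightarrow\Delta,[\Lambda\Rightarrow\Theta,\langle\Sigma\Rightarrow\Pi\rangle],\langle\ \Rightarrow[\Sigma\Rightarrow\Pi]\rangle\}$ / $G\{\Gamma\Rightarrow\Delta,[\Lambda\Rightarrow\Theta,\langle\Sigma\Rightarrow\Pi\rangle]\}$.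 A proof is a finite tree of such rule instances whose leaves are axioms. -}

module Defs where

open import Data.Nat using (ℕ)
open import Data.List using (List; []; _∷_; _++_; [_]; map)
open import Data.List.Relation.Binary.Permutation.Propositional using (_↭_)

infixr 8 _∧_
infixr 7 _∨_
infixr 6 _⊃_

data Fm : Set where
  atom : ℕ → Fm
  ⊥̂ ⊤̂ : Fm
  _∧_ _∨_ _⊃_ : Fm → Fm → Fm
  □ ◇ : Fm → Fm

-- A multiset of input formulas, output formulas and blocks is represented
-- by three lists: inputs, outputs, blocks. Multiset identity is recovered
-- by the (deep) permutation relation _≈ᴾ_ and an exchange rule.

infixr 30 _⊕_
infix 40 _• _∘

data PSeq : Set where
  psq : List Fm → List Fm → List PSeq → PSeq

_⊕_ : PSeq → PSeq → PSeq
psq I O B ⊕ psq I' O' B' = psq (I ++ I') (O ++ O') (B ++ B')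

∅ᴾ : PSeq
∅ᴾ = psq [] [] []

_• : Fm → PSeq
A • = psq [ A ] [] []

_∘ : Fm → PSeq
A ∘ = psq [] [ A ] []

blk : PSeq → PSeq
blk S = psq [] [] [ S ]

mutual
  data _≈ᴾ_ : PSeq → PSeq → Set where
    psq≈ : ∀ {I I' O O' B B'} → I ↭ I' → O ↭ O' → B ≋ᴾ B' → psq I O B ≈ᴾ psq I' O' B'

  data _≋ᴾ_ : List PSeq → List PSeq → Set where
    []≋ : [] ≋ᴾ []
    cons≋ : ∀ {x y xs ys} → x ≈ᴾ y → xs ≋ᴾ ys → (x ∷ xs) ≋ᴾ (y ∷ ys)
    swap≋ : ∀ x y xs → (x ∷ y ∷ xs) ≋ᴾ (y ∷ x ∷ xs)
    trans≋ : ∀ {xs ys zs} → xs ≋ᴾ ys → ys ≋ᴾ zs → xs ≋ᴾ zs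

-- Polarised contexts: a hole at some depth. `here S` is the multiset S
-- containing the hole; `inside S C` is S together with a block [C].
data PCtx : Set where
  here   : PSeq → PCtx
  inside : PSeq → PCtx → PCtx

_⟦_⟧ : PCtx → PSeq → PSeq
here S ⟦ Π ⟧ = S ⊕ Π
inside S C ⟦ Π ⟧ = S ⊕ blk (C ⟦ Π ⟧)

mutual
  erase : PSeq → PSeq
  erase (psq I O B) = psq I [] (eraseL B)

  eraseL : List PSeq → List PSeq
  eraseL [] = []
  eraseL (S ∷ Ss) = erase S ∷ eraseL Ss

_↓ : PCtx → PCtx
here S ↓ = here (erase S)
inside S C ↓ = inside (erase S) (C ↓)

-- The calculus NIKm (plus exchange, i.e. working modulo multisets)

data NIKm : PSeq → Set where
  exch : ∀ {S S'} → S ≈ᴾ S' → NIKm S → NIKm S'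
  ax⊥  : ∀ C → NIKm (C ⟦ ⊥̂ • ⟧)
  axp  : ∀ C p → NIKm (C ⟦ atom p • ⊕ atom p ∘ ⟧)
  ∧•   : ∀ C A B → NIKm (C ⟦ A • ⊕ B • ⟧) → NIKm (C ⟦ (A ∧ B) • ⟧)
  ∧∘   : ∀ C A B → NIKm (C ⟦ A ∘ ⟧) → NIKm (C ⟦ B ∘ ⟧) → NIKm (C ⟦ (A ∧ B) ∘ ⟧)
  ∨•   : ∀ C A B → NIKm (C ⟦ A • ⟧) → NIKm (C ⟦ B • ⟧) → NIKm (C ⟦ (A ∨ B) • ⟧)
  ∨∘   : ∀ C A B → NIKm (C ⟦ A ∘ ⊕ B ∘ ⟧) → NIKm (C ⟦ (A ∨ B) ∘ ⟧)
  ⊃•   : ∀ C A B → NIKm (C ⟦ A ∘ ⟧) → NIKm (C ⟦ B • ⟧) → NIKm (C ⟦ (A ⊃ B) • ⟧)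
  ⊃∘   : ∀ C A B → NIKm ((C ↓) ⟦ A • ⊕ B ∘ ⟧) → NIKm (C ⟦ (A ⊃ B) ∘ ⟧)
  □•   : ∀ C A Δ → NIKm (C ⟦ blk (Δ ⊕ A •) ⟧) → NIKm (C ⟦ □ A • ⊕ blk Δ ⟧)
  □∘   : ∀ C A → NIKm ((C ↓) ⟦ blk (A ∘) ⟧) → NIKm (C ⟦ □ A ∘ ⟧)
  ◇•   : ∀ C A → NIKm (C ⟦ blk (A •) ⟧) → NIKm (C ⟦ ◇ A • ⟧)
  ◇∘   : ∀ C A Δ → NIKm (C ⟦ blk (Δ ⊕ A ∘) ⟧) → NIKm (C ⟦ ◇ A ∘ ⊕ blk Δ ⟧)
  cont• : ∀ C A → NIKm (C ⟦ A • ⊕ A • ⟧) → NIKm (C ⟦ A • ⟧)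
  cont∘ : ∀ C A → NIKm (C ⟦ A ∘ ⊕ A ∘ ⟧) → NIKm (C ⟦ A ∘ ⟧)

-- Bi-nested sequents  Γ ⇒ Δ, ⟨S₁⟩,…,⟨Sₘ⟩, [T₁],…,[Tₙ]
-- bsq Γ Δ imps mods

data BSeq : Set where
  bsq : List Fm → List Fm → List BSeq → List BSeq → BSeq

mutual
  data _≈ᴮ_ : BSeq → BSeq → Set where
    bsq≈ : ∀ {Γ Γ' Δ Δ' I I' M M'} → Γ ↭ Γ' → Δ ↭ Δ' → I ≋ᴮ I' → M ≋ᴮ M' →
           bsq Γ Δ I M ≈ᴮ bsq Γ' Δ' I' M'

  data _≋ᴮ_ : List BSeq → List BSeq → Set where
    []≋ : [] ≋ᴮ []
    cons≋ : ∀ {x y xs ys} → x ≈ᴮ y → xs ≋ᴮ ys → (x ∷ xs) ≋ᴮ (y ∷ ys)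
    swap≋ : ∀ x y xs → (x ∷ y ∷ xs) ≋ᴮ (y ∷ x ∷ xs)
    trans≋ : ∀ {xs ys zs} → xs ≋ᴮ ys → ys ≋ᴮ zs → xs ≋ᴮ zs

-- contexts: { }, Γ ⇒ Δ,⟨G'{ }⟩, Γ ⇒ Δ,[G'{ }]
-- (Δ's remaining implication and modal blocks are the two lists)
data BCtx : Set where
  top  : BCtx
  inI  : List Fm → List Fm → List BSeq → List BSeq → BCtx → BCtx
  inM  : List Fm → List Fm → List BSeq → List BSeq → BCtx → BCtx

_⟪_⟫ : BCtx → BSeq → BSeq
top ⟪ S ⟫ = S
inI Γ Δ I M G ⟪ S ⟫ = bsq Γ Δ (G ⟪ S ⟫ ∷ I) M
inM Γ Δ I M G ⟪ S ⟫ = bsq Γ Δ I (G ⟪ S ⟫ ∷ M)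

addL : List Fm → BSeq → BSeq
addL Γ' (bsq Γ Δ I M) = bsq (Γ' ++ Γ) Δ I M

addR : Fm → BSeq → BSeq
addR A (bsq Γ Δ I M) = bsq Γ (A ∷ Δ) I M

addImp : BSeq → BSeq → BSeq
addImp S (bsq Γ Δ I M) = bsq Γ Δ (S ∷ I) M

addMod : BSeq → BSeq → BSeq
addMod S (bsq Γ Δ I M) = bsq Γ Δ I (S ∷ M)

mutual
  star : BSeq → BSeq
  star (bsq Λ Θ I M) = bsq Λ [] [] (starL M)

  starL : List BSeq → List BSeq
  starL [] = []
  starL (S ∷ Ss) = star S ∷ starL Ss

-- The calculus C_IK (plus exchange, i.e. working modulo multisets)

data CIK : BSeq → Set where
  exch : ∀ {S S'} → S ≈ᴮ S' → CIK S → CIK S'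
  ax⊥ : ∀ G Γ Δ I M → CIK (G ⟪ bsq (⊥̂ ∷ Γ) Δ I M ⟫)
  ax⊤ : ∀ G Γ Δ I M → CIK (G ⟪ bsq Γ (⊤̂ ∷ Δ) I M ⟫)
  axp : ∀ G p Γ Δ I M → CIK (G ⟪ bsq (atom p ∷ Γ) (atom p ∷ Δ) I M ⟫)
  ∧L : ∀ G A B Γ Δ I M → CIK (G ⟪ bsq (A ∷ B ∷ Γ) Δ I M ⟫) →
       CIK (G ⟪ bsq (A ∧ B ∷ Γ) Δ I M ⟫)
  ∧R : ∀ G A B Γ Δ I M → CIK (G ⟪ bsq Γ (A ∷ Δ) I M ⟫) → CIK (G ⟪ bsq Γ (B ∷ Δ) I M ⟫) →
       CIK (G ⟪ bsq Γ (A ∧ B ∷ Δ) I M ⟫)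
  ∨L : ∀ G A B Γ Δ I M → CIK (G ⟪ bsq (A ∷ Γ) Δ I M ⟫) → CIK (G ⟪ bsq (B ∷ Γ) Δ I M ⟫) →
       CIK (G ⟪ bsq (A ∨ B ∷ Γ) Δ I M ⟫)
  ∨R : ∀ G A B Γ Δ I M → CIK (G ⟪ bsq Γ (A ∷ B ∷ Δ) I M ⟫) →
       CIK (G ⟪ bsq Γ (A ∨ B ∷ Δ) I M ⟫)
  ⊃L : ∀ G A B Γ Δ I M → CIK (G ⟪ bsq (A ⊃ B ∷ Γ) (A ∷ Δ) I M ⟫) →
       CIK (G ⟪ bsq (B ∷ Γ) Δ I M ⟫) → CIK (G ⟪ bsq (A ⊃ B ∷ Γ) Δ I M ⟫)
  ⊃R : ∀ G A B Γ Δ I M → CIK (G ⟪ bsq Γ Δ (bsq [ A ] [ B ] [] [] ∷ I) M ⟫) →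
       CIK (G ⟪ bsq Γ (A ⊃ B ∷ Δ) I M ⟫)
  □L : ∀ G A Γ Δ I M T → CIK (G ⟪ bsq (□ A ∷ Γ) Δ I (addL [ A ] T ∷ M) ⟫) →
       CIK (G ⟪ bsq (□ A ∷ Γ) Δ I (T ∷ M) ⟫)
  □R : ∀ G A Γ Δ I M →
       CIK (G ⟪ bsq Γ Δ (bsq [] [] [] [ bsq [] [ A ] [] [] ] ∷ I) M ⟫) →
       CIK (G ⟪ bsq Γ (□ A ∷ Δ) I M ⟫)
  ◇L : ∀ G A Γ Δ I M → CIK (G ⟪ bsq Γ Δ I (bsq [ A ] [] [] [] ∷ M) ⟫) →
       CIK (G ⟪ bsq (◇ A ∷ Γ) Δ I M ⟫)
  ◇R : ∀ G A Γ Δ I M T → CIK (G ⟪ bsq Γ (◇ A ∷ Δ) I (addR A T ∷ M) ⟫) →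
       CIK (G ⟪ bsq Γ (◇ A ∷ Δ) I (T ∷ M) ⟫)
  trans : ∀ G Γ Γ' Δ I M T → CIK (G ⟪ bsq (Γ ++ Γ') Δ (addL Γ' T ∷ I) M ⟫) →
          CIK (G ⟪ bsq (Γ ++ Γ') Δ (T ∷ I) M ⟫)
  interfc : ∀ G Γ Δ I M S T → CIK (G ⟪ bsq Γ Δ (addMod (star T) S ∷ I) (T ∷ M) ⟫) →
            CIK (G ⟪ bsq Γ Δ (S ∷ I) (T ∷ M) ⟫)
  interbc : ∀ G Γ Δ I M S T →
            CIK (G ⟪ bsq Γ Δ (bsq [] [] [] [ S ] ∷ I) (addImp S T ∷ M) ⟫) →
            CIK (G ⟪ bsq Γ Δ I (addImp S T ∷ M) ⟫)

mutual
  fl : PSeq → BSeq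
  fl (psq I O B) = bsq I O [] (flL B)

  flL : List PSeq → List BSeq
  flL [] = []
  flL (S ∷ Ss) = fl S ∷ flL Ss

-- We prove more generally that C_IK proves every bi-nested sequent V
-- realising Σ (Σ ⊑ V): the inputs and outputs of Σ are covered on the left and
-- right of V, and each block of Σ is realised by a modal block of V.  Then each
-- NIKm rule becomes the matching C_IK rule at the corresponding node of V.
-- The rules for (A ⊃ B)° and (□ A)° erase all outputs; C_IK instead opens an
-- implication block at the hole, and (inter_bc), (trans) and (inter_fc) carry
-- that block to the root, where it has collected exactly the inputs and
-- positive parts that the erased context keeps.  Finally Σ ⊑ fl Σ.

module Submission where

open import Defs
open import Data.List using (List; []; _∷_; _++_; [_])
open import Data.List.Relation.Unary.All as All using (All; []; _∷_)
import Data.List.Relation.Unary.All.Properties as All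
open import Data.List.Relation.Unary.Any as Any using (Any; here; there)
open import Data.List.Membership.Propositional using (_∈_; find; lose)
open import Data.List.Membership.Propositional.Properties
  using (∈-∃++; ∈-++⁺ˡ; ∈-++⁺ʳ; ∈-++⁻; ∈-insert)
open import Data.List.Relation.Binary.Permutation.Propositional using (_↭_; ↭-refl; ↭-sym)
open import Data.List.Relation.Binary.Permutation.Propositional.Properties
  using (shift; All-resp-↭)
open import Data.Product using (∃; ∃₂; _×_; _,_)
open import Data.Sum using (_⊎_; inj₁; inj₂)
open import Data.Unit using (⊤; tt)
open import Relation.Binary.PropositionalEquality using (_≡_; refl; sym; cong; subst)

module _ {X : Set} where

  ∈-middle⁻ : ∀ {x y : X} M₁ {M₂} → y ∈ M₁ ++ x ∷ M₂ → y ≡ x ⊎ y ∈ M₁ ++ M₂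
  ∈-middle⁻ M₁ m with ∈-++⁻ M₁ m
  ... | inj₁ m₁          = inj₂ (∈-++⁺ˡ m₁)
  ... | inj₂ (here y≡x)  = inj₁ y≡x
  ... | inj₂ (there m₂)  = inj₂ (∈-++⁺ʳ M₁ m₂)

  ∈-middle⁺ : ∀ {x y : X} M₁ {M₂} → y ∈ M₁ ++ M₂ → y ∈ M₁ ++ x ∷ M₂
  ∈-middle⁺ M₁ m with ∈-++⁻ M₁ m
  ... | inj₁ m₁ = ∈-++⁺ˡ m₁
  ... | inj₂ m₂ = ∈-++⁺ʳ M₁ (there m₂)

  any-split : ∀ {P : X → Set} {xs} → Any P xs → ∃₂ λ ys y → ∃ λ zs → xs ≡ ys ++ y ∷ zs × P y
  any-split a with find a
  ... | y , y∈xs , py with ∈-∃++ y∈xs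
  ... | ys , zs , eq = ys , y , zs , eq , py

  extract : ∀ {x : X} {xs} → x ∈ xs →
            ∃ λ rest → xs ↭ x ∷ rest × (∀ {y} → y ∈ xs → y ≡ x ⊎ y ∈ rest)
  extract {x} x∈xs with ∈-∃++ x∈xs
  ... | ys , zs , refl = ys ++ zs , shift x ys zs , ∈-middle⁻ ys

lefts rights : BSeq → List Fm
lefts  (bsq Γ Δ I M) = Γ
rights (bsq Γ Δ I M) = Δ

mods : BSeq → List BSeq
mods (bsq Γ Δ I M) = M

-- A formula is covered on a side of V if it occurs there, or if V already
-- holds what the invertible rules of C_IK decompose it into.  This lets a
-- single C_IK rule application serve every copy that NIKm has contracted.
CoveredL : BSeq → Fm → Set
CoveredL V (A ∧ B) = A ∧ B ∈ lefts V ⊎ CoveredL V A × CoveredL V B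
CoveredL V (A ∨ B) = A ∨ B ∈ lefts V ⊎ CoveredL V A ⊎ CoveredL V B
CoveredL V (A ⊃ B) = A ⊃ B ∈ lefts V ⊎ CoveredL V B
CoveredL V (◇ A)   = ◇ A ∈ lefts V ⊎ Any (λ T → CoveredL T A) (mods V)
CoveredL V (atom p) = atom p ∈ lefts V
CoveredL V ⊥̂       = ⊥̂ ∈ lefts V
CoveredL V ⊤̂       = ⊤̂ ∈ lefts V
CoveredL V (□ A)   = □ A ∈ lefts V

CoveredR : BSeq → Fm → Set
CoveredR V (A ∧ B) = A ∧ B ∈ rights V ⊎ CoveredR V A ⊎ CoveredR V B
CoveredR V (A ∨ B) = A ∨ B ∈ rights V ⊎ CoveredR V A × CoveredR V B
CoveredR V (A ⊃ B) = A ⊃ B ∈ rights V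
CoveredR V (◇ A)   = ◇ A ∈ rights V
CoveredR V (atom p) = atom p ∈ rights V
CoveredR V ⊥̂       = ⊥̂ ∈ rights V
CoveredR V ⊤̂       = ⊤̂ ∈ rights V
CoveredR V (□ A)   = □ A ∈ rights V

infix 4 _⊑_ _⊑*_ _≼_ _≼*_

mutual
  _⊑_ : PSeq → BSeq → Set
  psq I O B ⊑ V = All (CoveredL V) I × All (CoveredR V) O × B ⊑* mods V

  _⊑*_ : List PSeq → List BSeq → Set
  []      ⊑* M = ⊤
  (S ∷ B) ⊑* M = Any (S ⊑_) M × B ⊑* M

_≼_ : BSeq → BSeq → Set
U ≼ V = ∀ S → S ⊑ U → S ⊑ V

_≼*_ : List BSeq → List BSeq → Set
M ≼* M' = ∀ {T} → T ∈ M → ∃ λ T' → T' ∈ M' × T ≼ T'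

≼-refl : ∀ {V} → V ≼ V
≼-refl S r = r

≼*-refl : ∀ {M} → M ≼* M
≼*-refl T∈M = _ , T∈M , ≼-refl

≼-coveredL : ∀ {U V A} → U ≼ V → CoveredL U A → CoveredL V A
≼-coveredL {A = A} U≼V c with U≼V (A •) (c ∷ [] , [] , tt)
... | c' ∷ [] , _ = c'

≼*-any : ∀ {P : BSeq → Set} → (∀ {T T'} → T ≼ T' → P T → P T') →
         ∀ {M M'} → M ≼* M' → Any P M → Any P M'
≼*-any mono M≼M' a with find a
... | _ , T∈M , pT with M≼M' T∈M
... | _ , T'∈M' , T≼T' = lose T'∈M' (mono T≼T' pT)

∈⇒coveredL : ∀ V {A} → A ∈ lefts V → CoveredL V A
∈⇒coveredL V {atom p} m = m
∈⇒coveredL V {⊥̂}     m = m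
∈⇒coveredL V {⊤̂}     m = m
∈⇒coveredL V {A ∧ B}  m = inj₁ m
∈⇒coveredL V {A ∨ B}  m = inj₁ m
∈⇒coveredL V {A ⊃ B}  m = inj₁ m
∈⇒coveredL V {□ A}    m = m
∈⇒coveredL V {◇ A}    m = inj₁ m

∈⇒coveredR : ∀ V {A} → A ∈ rights V → CoveredR V A
∈⇒coveredR V {atom p} m = m
∈⇒coveredR V {⊥̂}     m = m
∈⇒coveredR V {⊤̂}     m = m
∈⇒coveredR V {A ∧ B}  m = inj₁ m
∈⇒coveredR V {A ∨ B}  m = inj₁ m
∈⇒coveredR V {A ⊃ B}  m = m
∈⇒coveredR V {□ A}    m = m
∈⇒coveredR V {◇ A}    m = m

coveredL-mono : ∀ {U V} → (∀ {A} → A ∈ lefts U → CoveredL V A) →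
                (∀ {A} → Any (λ T → CoveredL T A) (mods U) → Any (λ T → CoveredL T A) (mods V)) →
                ∀ {A} → CoveredL U A → CoveredL V A
coveredL-mono f g {A ∧ B}  (inj₁ m)          = f m
coveredL-mono f g {A ∧ B}  (inj₂ (a , b))    = inj₂ (coveredL-mono f g a , coveredL-mono f g b)
coveredL-mono f g {A ∨ B}  (inj₁ m)          = f m
coveredL-mono f g {A ∨ B}  (inj₂ (inj₁ a))   = inj₂ (inj₁ (coveredL-mono f g a))
coveredL-mono f g {A ∨ B}  (inj₂ (inj₂ b))   = inj₂ (inj₂ (coveredL-mono f g b))
coveredL-mono f g {A ⊃ B}  (inj₁ m)          = f m
coveredL-mono f g {A ⊃ B}  (inj₂ b)          = inj₂ (coveredL-mono f g b)
coveredL-mono f g {◇ A}    (inj₁ m)          = f m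
coveredL-mono f g {◇ A}    (inj₂ a)          = inj₂ (g a)
coveredL-mono f g {atom p} m                 = f m
coveredL-mono f g {⊥̂}     m                 = f m
coveredL-mono f g {⊤̂}     m                 = f m
coveredL-mono f g {□ A}    m                 = f m

coveredR-mono : ∀ {U V} → (∀ {A} → A ∈ rights U → CoveredR V A) →
                ∀ {A} → CoveredR U A → CoveredR V A
coveredR-mono f {A ∧ B}  (inj₁ m)          = f m
coveredR-mono f {A ∧ B}  (inj₂ (inj₁ a))   = inj₂ (inj₁ (coveredR-mono f a))
coveredR-mono f {A ∧ B}  (inj₂ (inj₂ b))   = inj₂ (inj₂ (coveredR-mono f b))
coveredR-mono f {A ∨ B}  (inj₁ m)          = f m
coveredR-mono f {A ∨ B}  (inj₂ (a , b))    = inj₂ (coveredR-mono f a , coveredR-mono f b)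
coveredR-mono f {A ⊃ B}  m                 = f m
coveredR-mono f {◇ A}    m                 = f m
coveredR-mono f {atom p} m                 = f m
coveredR-mono f {⊥̂}     m                 = f m
coveredR-mono f {⊤̂}     m                 = f m
coveredR-mono f {□ A}    m                 = f m

⊑*-map : ∀ {M M'} → (∀ {S} → Any (S ⊑_) M → Any (S ⊑_) M') → ∀ {B} → B ⊑* M → B ⊑* M'
⊑*-map f {[]}    tt      = tt
⊑*-map f {S ∷ B} (a , r) = f a , ⊑*-map f r

≼-node : ∀ {U V} → (∀ {A} → A ∈ lefts U → CoveredL V A) →
         (∀ {A} → A ∈ rights U → CoveredR V A) →
         mods U ≼* mods V → U ≼ V
≼-node f g h (psq I O B) (cI , cO , rB) =
  All.map (coveredL-mono f (≼*-any ≼-coveredL h)) cI ,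
  All.map (coveredR-mono g) cO ,
  ⊑*-map (≼*-any (λ T≼T' → T≼T' _) h) rB

⊑*-++⁺ : ∀ B {B' M} → B ⊑* M → B' ⊑* M → B ++ B' ⊑* M
⊑*-++⁺ []      r        r' = r'
⊑*-++⁺ (S ∷ B) (a , r)  r' = a , ⊑*-++⁺ B r r'

⊑*-++⁻ : ∀ B {B' M} → B ++ B' ⊑* M → B ⊑* M × B' ⊑* M
⊑*-++⁻ []      r       = tt , r
⊑*-++⁻ (S ∷ B) (a , r) with ⊑*-++⁻ B r
... | r₁ , r₂ = (a , r₁) , r₂

⊑-⊕⁺ : ∀ S P {V} → S ⊑ V → P ⊑ V → S ⊕ P ⊑ V
⊑-⊕⁺ (psq I O B) (psq I' O' B') (a , b , c) (a' , b' , c') =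
  All.++⁺ a a' , All.++⁺ b b' , ⊑*-++⁺ B c c'

⊑-⊕⁻ : ∀ S P {V} → S ⊕ P ⊑ V → S ⊑ V × P ⊑ V
⊑-⊕⁻ (psq I O B) (psq I' O' B') (a , b , c) with ⊑*-++⁻ B c
... | c₁ , c₂ = (All.++⁻ˡ I a , All.++⁻ˡ O b , c₁) , (All.++⁻ʳ I a , All.++⁻ʳ O b , c₂)

mutual
  ≈ᴾ-⊑ : ∀ {S S' V} → S ≈ᴾ S' → S' ⊑ V → S ⊑ V
  ≈ᴾ-⊑ (psq≈ p q e) (a , b , c) = All-resp-↭ (↭-sym p) a , All-resp-↭ (↭-sym q) b , ≋ᴾ-⊑* e c

  ≋ᴾ-⊑* : ∀ {B B' M} → B ≋ᴾ B' → B' ⊑* M → B ⊑* M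
  ≋ᴾ-⊑* []≋              r           = tt
  ≋ᴾ-⊑* (cons≋ x≈y e)    (a , r)     = ≈ᴾ-any x≈y a , ≋ᴾ-⊑* e r
  ≋ᴾ-⊑* (swap≋ x y xs)   (a , b , r) = b , a , r
  ≋ᴾ-⊑* (trans≋ e f)     r           = ≋ᴾ-⊑* e (≋ᴾ-⊑* f r)

  ≈ᴾ-any : ∀ {S S' M} → S ≈ᴾ S' → Any (S' ⊑_) M → Any (S ⊑_) M
  ≈ᴾ-any e (here r)  = here (≈ᴾ-⊑ e r)
  ≈ᴾ-any e (there a) = there (≈ᴾ-any e a)

-- frame Γ Δ I M₁ M₂ is the node Γ ⇒ Δ, I, M₁ ++ [ hole ] ++ M₂ of a path.
data Frame : Set where
  frame : List Fm → List Fm → List BSeq → List BSeq → List BSeq → Frame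

plug : List Frame → BSeq → BSeq
plug []                      N = N
plug (frame Γ Δ I M₁ M₂ ∷ G) N = bsq Γ Δ I (M₁ ++ plug G N ∷ M₂)

-- C_IK contexts keep the hole first among the modal blocks, so toCtx G ⟪ N ⟫
-- and plug G N agree only up to exchange.
toCtx : List Frame → BCtx
toCtx []                      = top
toCtx (frame Γ Δ I M₁ M₂ ∷ G) = inM Γ Δ I (M₁ ++ M₂) (toCtx G)

data RealisedCtx : PCtx → List Frame → BSeq → Set where
  atHole  : ∀ {S N} → S ⊑ N → RealisedCtx (here S) [] N
  inBlock : ∀ {S C Γ Δ I M₁ M₂ G N} → S ⊑ bsq Γ Δ I (M₁ ++ plug G N ∷ M₂) →
            RealisedCtx C G N → RealisedCtx (inside S C) (frame Γ Δ I M₁ M₂ ∷ G) N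

record Location (C : PCtx) (Π : PSeq) (V : BSeq) : Set where
  constructor location
  field
    path      : List Frame
    node      : BSeq
    V≡plug    : V ≡ plug path node
    filling   : Π ⊑ node
    realised  : RealisedCtx C path node

locate : ∀ C Π V → C ⟦ Π ⟧ ⊑ V → Location C Π V
locate (here S) Π V r with ⊑-⊕⁻ S Π r
... | rS , rΠ = location [] V refl rΠ (atHole rS)
locate (inside S C) Π (bsq Γ Δ I M) r with ⊑-⊕⁻ S (blk (C ⟦ Π ⟧)) r
... | rS , (_ , _ , a , _) with any-split a
... | M₁ , Y , M₂ , refl , rY with locate C Π Y rY
... | location G N refl rΠ c = location (frame Γ Δ I M₁ M₂ ∷ G) N refl rΠ (inBlock rS c)

≼-frame : ∀ {Γ Δ I} M₁ {M₂ T T'} → T ≼ T' →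
          bsq Γ Δ I (M₁ ++ T ∷ M₂) ≼ bsq Γ Δ I (M₁ ++ T' ∷ M₂)
≼-frame {Γ} {Δ} {I} M₁ {M₂} {T} {T'} T≼T' =
  ≼-node (∈⇒coveredL _) (∈⇒coveredR _) replace
  where
  replace : M₁ ++ T ∷ M₂ ≼* M₁ ++ T' ∷ M₂
  replace m with ∈-middle⁻ M₁ m
  ... | inj₁ refl = T' , ∈-insert M₁ , T≼T'
  ... | inj₂ m'   = _ , ∈-middle⁺ M₁ m' , ≼-refl

≼-plug : ∀ G {N N'} → N ≼ N' → plug G N ≼ plug G N'
≼-plug []                      N≼N' = N≼N'
≼-plug (frame Γ Δ I M₁ M₂ ∷ G) N≼N' = ≼-frame M₁ (≼-plug G N≼N')

⊑-refill : ∀ {C G N N' Π} → RealisedCtx C G N → N ≼ N' → Π ⊑ N' → C ⟦ Π ⟧ ⊑ plug G N'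
⊑-refill {here S} {N' = N'} {Π} (atHole r) N≼N' rΠ = ⊑-⊕⁺ S Π (N≼N' S r) rΠ
⊑-refill {inside S C} {frame Γ Δ I M₁ M₂ ∷ G} {Π = Π} (inBlock r c) N≼N' rΠ =
  ⊑-⊕⁺ S (blk (C ⟦ Π ⟧)) (≼-frame M₁ (≼-plug G N≼N') S r)
    ([] , [] , lose (∈-insert M₁) (⊑-refill c N≼N' rΠ) , tt)

mutual
  ≈ᴮ-refl : ∀ S → S ≈ᴮ S
  ≈ᴮ-refl (bsq Γ Δ I M) = bsq≈ ↭-refl ↭-refl (≋ᴮ-refl I) (≋ᴮ-refl M)

  ≋ᴮ-refl : ∀ L → L ≋ᴮ L
  ≋ᴮ-refl []      = []≋
  ≋ᴮ-refl (S ∷ L) = cons≋ (≈ᴮ-refl S) (≋ᴮ-refl L)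

⟪⟫-cong : ∀ G {S S'} → S ≈ᴮ S' → (G ⟪ S ⟫) ≈ᴮ (G ⟪ S' ⟫)
⟪⟫-cong top             e = e
⟪⟫-cong (inI Γ Δ I M G) e = bsq≈ ↭-refl ↭-refl (cons≋ (⟪⟫-cong G e) (≋ᴮ-refl I)) (≋ᴮ-refl M)
⟪⟫-cong (inM Γ Δ I M G) e = bsq≈ ↭-refl ↭-refl (≋ᴮ-refl I) (cons≋ (⟪⟫-cong G e) (≋ᴮ-refl M))

≋ᴮ-fromFront : ∀ T M₁ M₂ → (T ∷ M₁ ++ M₂) ≋ᴮ (M₁ ++ T ∷ M₂)
≋ᴮ-fromFront T []       M₂ = ≋ᴮ-refl _
≋ᴮ-fromFront T (S ∷ M₁) M₂ =
  trans≋ (swap≋ T S (M₁ ++ M₂)) (cons≋ (≈ᴮ-refl S) (≋ᴮ-fromFront T M₁ M₂))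

≋ᴮ-toFront : ∀ T M₁ M₂ → (M₁ ++ T ∷ M₂) ≋ᴮ (T ∷ M₁ ++ M₂)
≋ᴮ-toFront T []       M₂ = ≋ᴮ-refl _
≋ᴮ-toFront T (S ∷ M₁) M₂ =
  trans≋ (cons≋ (≈ᴮ-refl S) (≋ᴮ-toFront T M₁ M₂)) (swap≋ S T (M₁ ++ M₂))

toCtx≈plug : ∀ G S → (toCtx G ⟪ S ⟫) ≈ᴮ plug G S
toCtx≈plug []                      S = ≈ᴮ-refl S
toCtx≈plug (frame Γ Δ I M₁ M₂ ∷ G) S =
  bsq≈ ↭-refl ↭-refl (≋ᴮ-refl I)
    (trans≋ (cons≋ (toCtx≈plug G S) (≋ᴮ-refl _)) (≋ᴮ-fromFront _ M₁ M₂))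

plug≈toCtx : ∀ G S → plug G S ≈ᴮ (toCtx G ⟪ S ⟫)
plug≈toCtx []                      S = ≈ᴮ-refl S
plug≈toCtx (frame Γ Δ I M₁ M₂ ∷ G) S =
  bsq≈ ↭-refl ↭-refl (≋ᴮ-refl I)
    (trans≋ (≋ᴮ-toFront _ M₁ M₂) (cons≋ (plug≈toCtx G S) (≋ᴮ-refl _)))

exchAt : ∀ G {Γ Γ' Δ Δ' I M M'} → Γ' ↭ Γ → Δ' ↭ Δ → M' ≋ᴮ M →
         CIK (G ⟪ bsq Γ' Δ' I M' ⟫) → CIK (G ⟪ bsq Γ Δ I M ⟫)
exchAt G p q e d = exch (⟪⟫-cong G (bsq≈ p q (≋ᴮ-refl _) e)) d

infixr 9 _·_

_·_ : BCtx → BCtx → BCtx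
top           · H = H
inI Γ Δ I M G · H = inI Γ Δ I M (G · H)
inM Γ Δ I M G · H = inM Γ Δ I M (G · H)

·-⟪⟫ : ∀ G H S → ((G · H) ⟪ S ⟫) ≡ (G ⟪ H ⟪ S ⟫ ⟫)
·-⟪⟫ top             H S = refl
·-⟪⟫ (inI Γ Δ I M G) H S = cong (λ X → bsq Γ Δ (X ∷ I) M) (·-⟪⟫ G H S)
·-⟪⟫ (inM Γ Δ I M G) H S = cong (λ X → bsq Γ Δ I (X ∷ M)) (·-⟪⟫ G H S)

nest : ∀ H G {S} → CIK ((H · G) ⟪ S ⟫) → CIK (H ⟪ G ⟪ S ⟫ ⟫)
nest H G {S} = subst CIK (·-⟪⟫ H G S)

unnest : ∀ H G {S} → CIK (H ⟪ G ⟪ S ⟫ ⟫) → CIK ((H · G) ⟪ S ⟫)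
unnest H G {S} = subst CIK (sym (·-⟪⟫ H G S))

CIK-inCtx : ∀ {S} → CIK S → ∀ H → CIK (H ⟪ S ⟫)
CIK-inCtx (exch e p) H = exch (⟪⟫-cong H e) (CIK-inCtx p H)
CIK-inCtx (ax⊥ G Γ Δ I M) H = nest H G (ax⊥ (H · G) Γ Δ I M)
CIK-inCtx (ax⊤ G Γ Δ I M) H = nest H G (ax⊤ (H · G) Γ Δ I M)
CIK-inCtx (axp G p Γ Δ I M) H = nest H G (axp (H · G) p Γ Δ I M)
CIK-inCtx (∧L G A B Γ Δ I M p) H = nest H G (∧L (H · G) A B Γ Δ I M (unnest H G (CIK-inCtx p H)))
CIK-inCtx (∧R G A B Γ Δ I M p q) H =
  nest H G (∧R (H · G) A B Γ Δ I M (unnest H G (CIK-inCtx p H)) (unnest H G (CIK-inCtx q H)))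
CIK-inCtx (∨L G A B Γ Δ I M p q) H =
  nest H G (∨L (H · G) A B Γ Δ I M (unnest H G (CIK-inCtx p H)) (unnest H G (CIK-inCtx q H)))
CIK-inCtx (∨R G A B Γ Δ I M p) H = nest H G (∨R (H · G) A B Γ Δ I M (unnest H G (CIK-inCtx p H)))
CIK-inCtx (⊃L G A B Γ Δ I M p q) H =
  nest H G (⊃L (H · G) A B Γ Δ I M (unnest H G (CIK-inCtx p H)) (unnest H G (CIK-inCtx q H)))
CIK-inCtx (⊃R G A B Γ Δ I M p) H = nest H G (⊃R (H · G) A B Γ Δ I M (unnest H G (CIK-inCtx p H)))
CIK-inCtx (□L G A Γ Δ I M T p) H = nest H G (□L (H · G) A Γ Δ I M T (unnest H G (CIK-inCtx p H)))
CIK-inCtx (□R G A Γ Δ I M p) H = nest H G (□R (H · G) A Γ Δ I M (unnest H G (CIK-inCtx p H)))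
CIK-inCtx (◇L G A Γ Δ I M p) H = nest H G (◇L (H · G) A Γ Δ I M (unnest H G (CIK-inCtx p H)))
CIK-inCtx (◇R G A Γ Δ I M T p) H = nest H G (◇R (H · G) A Γ Δ I M T (unnest H G (CIK-inCtx p H)))
CIK-inCtx (trans G Γ Γ' Δ I M T p) H =
  nest H G (trans (H · G) Γ Γ' Δ I M T (unnest H G (CIK-inCtx p H)))
CIK-inCtx (interfc G Γ Δ I M S T p) H =
  nest H G (interfc (H · G) Γ Δ I M S T (unnest H G (CIK-inCtx p H)))
CIK-inCtx (interbc G Γ Δ I M S T p) H =
  nest H G (interbc (H · G) Γ Δ I M S T (unnest H G (CIK-inCtx p H)))

CIK-inImp : ∀ {F} → CIK F → ∀ V → CIK (addImp F V)
CIK-inImp p (bsq Γ Δ I M) = CIK-inCtx p (inI Γ Δ I M top)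

-- Carrying an implication block to the root

addStars : List BSeq → BSeq → BSeq
addStars M (bsq Γ Δ I M') = bsq Γ Δ I (starL M ++ M')

inherit : List Fm → List BSeq → BSeq → BSeq
inherit Γ M W = addL Γ (addStars M W)

interfc* : ∀ G Γ Δ I M L W → (∀ {T} → T ∈ L → T ∈ M) →
           CIK (G ⟪ bsq Γ Δ (addStars L W ∷ I) M ⟫) → CIK (G ⟪ bsq Γ Δ (W ∷ I) M ⟫)
interfc* G Γ Δ I M []      (bsq _ _ _ _) L⊆M p = p
interfc* G Γ Δ I M (T ∷ L) W@(bsq _ _ _ _) L⊆M p with ∈-∃++ (L⊆M (here refl))
... | M₁ , M₂ , refl =
  interfc* G Γ Δ I _ L W (λ T∈L → L⊆M (there T∈L))
    (exchAt G ↭-refl ↭-refl (≋ᴮ-fromFront T M₁ M₂)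
      (interfc G Γ Δ I (M₁ ++ M₂) (addStars L W) T
        (exchAt G ↭-refl ↭-refl (≋ᴮ-toFront T M₁ M₂) p)))

saturate : ∀ G Γ Δ I M W → CIK (G ⟪ bsq Γ Δ (inherit Γ M W ∷ I) M ⟫) →
           CIK (G ⟪ bsq Γ Δ (W ∷ I) M ⟫)
saturate G Γ Δ I M W@(bsq _ _ _ _) p =
  trans G [] Γ Δ I M W (interfc* G Γ Δ I M M (addL Γ W) (λ T∈M → T∈M) p)

-- carried G N W is the block W at the hole N of plug G N as it arrives at the
-- root: moved one level up by (inter_bc) and enriched there by (trans) and
-- (inter_fc) at every frame.  carriedTree G N W is plug G N with these blocks
-- attached along the path.
mutual
  carried : List Frame → BSeq → BSeq → BSeq
  carried []                      (bsq Γ Δ I M) W = inherit Γ M W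
  carried (frame Γ Δ I M₁ M₂ ∷ G) N W =
    inherit Γ (carriedTree G N W ∷ M₁ ++ M₂) (bsq [] [] [] [ carried G N W ])

  carriedTree : List Frame → BSeq → BSeq → BSeq
  carriedTree G N W = addImp (carried G N W) (carriedBody G N W)

  carriedBody : List Frame → BSeq → BSeq → BSeq
  carriedBody []                      N W = N
  carriedBody (frame Γ Δ I M₁ M₂ ∷ G) N W = bsq Γ Δ I (carriedTree G N W ∷ M₁ ++ M₂)

uncarry : ∀ G H N W → CIK (H ⟪ carriedTree G N W ⟫) → CIK (H ⟪ toCtx G ⟪ addImp W N ⟫ ⟫)
uncarry []                      H (bsq Γ Δ I M) W p = saturate H Γ Δ I M W p
uncarry (frame Γ Δ I M₁ M₂ ∷ G) H N W p =
  nest H F (uncarry G (H · F) N W (unnest H F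
    (interbc H Γ Δ I (M₁ ++ M₂) (carried G N W) (carriedBody G N W)
      (saturate H Γ Δ I (carriedTree G N W ∷ M₁ ++ M₂) (bsq [] [] [] [ carried G N W ]) p))))
  where
  F : BCtx
  F = inM Γ Δ I (M₁ ++ M₂) top

starL-++ : ∀ M₁ M₂ → starL (M₁ ++ M₂) ≡ starL M₁ ++ starL M₂
starL-++ []       M₂ = refl
starL-++ (T ∷ M₁) M₂ = cong (star T ∷_) (starL-++ M₁ M₂)

≼*-toFront : ∀ M₁ {M₂ T T'} → T ≼ T' → (M₁ ++ T ∷ M₂) ≼* (T' ∷ M₁ ++ M₂)
≼*-toFront M₁ T≼T' m with ∈-middle⁻ M₁ m
... | inj₁ refl = _ , here refl , T≼T'
... | inj₂ m'   = _ , there m' , ≼-refl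

≼*-starL-toFront : ∀ M₁ {M₂ T T'} → star T ≼ star T' →
                   starL (M₁ ++ T ∷ M₂) ≼* starL (T' ∷ M₁ ++ M₂)
≼*-starL-toFront M₁ {M₂} {T} T≼T' rewrite starL-++ M₁ (T ∷ M₂) | starL-++ M₁ M₂ =
  ≼*-toFront (starL M₁) T≼T'

mutual
  coveredL-star : ∀ V {A} → CoveredL V A → CoveredL (star V) A
  coveredL-star (bsq Γ Δ I M) {A ∧ B}  (inj₁ m)        = inj₁ m
  coveredL-star V@(bsq _ _ _ _) {A ∧ B} (inj₂ (a , b)) = inj₂ (coveredL-star V a , coveredL-star V b)
  coveredL-star (bsq Γ Δ I M) {A ∨ B}  (inj₁ m)        = inj₁ m
  coveredL-star V@(bsq _ _ _ _) {A ∨ B} (inj₂ (inj₁ a)) = inj₂ (inj₁ (coveredL-star V a))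
  coveredL-star V@(bsq _ _ _ _) {A ∨ B} (inj₂ (inj₂ b)) = inj₂ (inj₂ (coveredL-star V b))
  coveredL-star (bsq Γ Δ I M) {A ⊃ B}  (inj₁ m)        = inj₁ m
  coveredL-star V@(bsq _ _ _ _) {A ⊃ B} (inj₂ b)       = inj₂ (coveredL-star V b)
  coveredL-star (bsq Γ Δ I M) {◇ A}    (inj₁ m)        = inj₁ m
  coveredL-star (bsq Γ Δ I M) {◇ A}    (inj₂ a)        = inj₂ (any-coveredL-star M a)
  coveredL-star (bsq Γ Δ I M) {atom p} m               = m
  coveredL-star (bsq Γ Δ I M) {⊥̂}     m               = m
  coveredL-star (bsq Γ Δ I M) {⊤̂}     m               = m
  coveredL-star (bsq Γ Δ I M) {□ A}    m               = m

  any-coveredL-star : ∀ M {A} → Any (λ T → CoveredL T A) M → Any (λ T → CoveredL T A) (starL M)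
  any-coveredL-star (T ∷ M) (here c)  = here (coveredL-star T c)
  any-coveredL-star (T ∷ M) (there a) = there (any-coveredL-star M a)

mutual
  ⊑-erase : ∀ {S V} → S ⊑ V → erase S ⊑ star V
  ⊑-erase {psq I O B} {V@(bsq _ _ _ M)} (a , b , c) = All.map (coveredL-star V) a , [] , ⊑*-erase B M c

  ⊑*-erase : ∀ B M → B ⊑* M → eraseL B ⊑* starL M
  ⊑*-erase []      M tt      = tt
  ⊑*-erase (S ∷ B) M (a , r) = any-erase M a , ⊑*-erase B M r

  any-erase : ∀ {S} M → Any (S ⊑_) M → Any (erase S ⊑_) (starL M)
  any-erase (T ∷ M) (here r)  = here (⊑-erase r)
  any-erase (T ∷ M) (there a) = there (any-erase M a)

star≼inherit : ∀ {Γ M M'} W → starL M ≼* starL M' → bsq Γ [] [] (starL M) ≼ inherit Γ M' W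
star≼inherit (bsq _ _ _ _) M≼M' =
  ≼-node (λ m → ∈⇒coveredL _ (∈-++⁺ˡ m)) (λ ())
    (λ m → let T' , m' , T≼T' = M≼M' m in T' , ∈-++⁺ˡ m' , T≼T')

≼-inherit : ∀ Γ M W → W ≼ inherit Γ M W
≼-inherit Γ M (bsq _ _ _ _) =
  ≼-node (λ m → ∈⇒coveredL _ (∈-++⁺ʳ Γ m)) (∈⇒coveredR _)
    (λ m → _ , ∈-++⁺ʳ (starL M) m , ≼-refl)

star-carriedTree : ∀ G {N N'} W → star N ≼ star N' → star (plug G N) ≼ star (carriedTree G N' W)
star-carriedTree []                      {N' = bsq _ _ _ _} W N≼N' = N≼N'
star-carriedTree (frame Γ Δ I M₁ M₂ ∷ G) W N≼N' =
  ≼-node (∈⇒coveredL _) (λ ()) (≼*-starL-toFront M₁ (star-carriedTree G W N≼N'))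

⊑-carried : ∀ {C G N} N' X Π → RealisedCtx C G N → star N ≼ star N' → Π ⊑ X →
            (C ↓) ⟦ Π ⟧ ⊑ carried G N' X
⊑-carried {here S} {[]} (bsq Γ Δ I M) X Π (atHole r) N≼N' rΠ =
  ⊑-⊕⁺ (erase S) Π (star≼inherit X ≼*-refl _ (N≼N' _ (⊑-erase r))) (≼-inherit Γ M X Π rΠ)
⊑-carried {inside S C} {frame Γ Δ I M₁ M₂ ∷ G} N' X Π (inBlock r c) N≼N' rΠ =
  ⊑-⊕⁺ (erase S) (blk ((C ↓) ⟦ Π ⟧))
    (star≼inherit (bsq [] [] [] [ carried G N' X ]) (≼*-starL-toFront M₁ (star-carriedTree G X N≼N'))
      _ (⊑-erase r))
    ([] , [] , lose (∈-++⁺ʳ (starL (carriedTree G N' X ∷ M₁ ++ M₂)) (here refl))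
                    (⊑-carried N' X Π c N≼N' rΠ) , tt)

Sound : PSeq → Set
Sound S = ∀ V → S ⊑ V → CIK V

conclude : ∀ G {N V} → V ≡ plug G N → CIK (toCtx G ⟪ N ⟫) → CIK V
conclude G {N} refl p = exch (toCtx≈plug G N) p

sound-at : ∀ {C Π G N} → Sound (C ⟦ Π ⟧) → RealisedCtx C G N → ∀ N' → N ≼ N' → Π ⊑ N' →
           CIK (toCtx G ⟪ N' ⟫)
sound-at {G = G} ih c N' N≼N' rΠ = exch (plug≈toCtx G N') (ih _ (⊑-refill c N≼N' rΠ))

reuse : ∀ {C Π G N V} → Sound (C ⟦ Π ⟧) → V ≡ plug G N → RealisedCtx C G N → Π ⊑ N → CIK V
reuse ih refl c rΠ = ih _ (⊑-refill c ≼-refl rΠ)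

coveredL-replace : ∀ N' {Γ Γr A} → (∀ {B} → B ∈ Γ → B ≡ A ⊎ B ∈ Γr) →
                   (∀ {B} → B ∈ Γr → B ∈ lefts N') →
                   CoveredL N' A → ∀ {B} → B ∈ Γ → CoveredL N' B
coveredL-replace N' f g c m with f m
... | inj₁ refl = c
... | inj₂ m'   = ∈⇒coveredL N' (g m')

coveredR-replace : ∀ N' {Δ Δr A} → (∀ {B} → B ∈ Δ → B ≡ A ⊎ B ∈ Δr) →
                   (∀ {B} → B ∈ Δr → B ∈ rights N') →
                   CoveredR N' A → ∀ {B} → B ∈ Δ → CoveredR N' B
coveredR-replace N' f g c m with f m
... | inj₁ refl = c
... | inj₂ m'   = ∈⇒coveredR N' (g m')

≼-addL : ∀ A T → T ≼ addL [ A ] T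
≼-addL A (bsq _ _ _ _) = ≼-node (λ m → ∈⇒coveredL _ (there m)) (∈⇒coveredR _) ≼*-refl

≼-addR : ∀ A T → T ≼ addR A T
≼-addR A (bsq _ _ _ _) = ≼-node (∈⇒coveredL _) (λ m → ∈⇒coveredR _ (there m)) ≼*-refl

addL-covers : ∀ A T → CoveredL (addL [ A ] T) A
addL-covers A T@(bsq _ _ _ _) = ∈⇒coveredL (addL [ A ] T) (here refl)

addR-covers : ∀ A T → CoveredR (addR A T) A
addR-covers A T@(bsq _ _ _ _) = ∈⇒coveredR (addR A T) (here refl)

ax⊥-sound : ∀ C → Sound (C ⟦ ⊥̂ • ⟧)
ax⊥-sound C V r with locate C (⊥̂ •) V r
... | location G (bsq Γ Δ I M) eq (m ∷ [] , [] , tt) _ with extract m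
... | Γr , perm , _ =
  conclude G eq (exchAt (toCtx G) (↭-sym perm) ↭-refl (≋ᴮ-refl M) (ax⊥ (toCtx G) Γr Δ I M))

axp-sound : ∀ C p → Sound (C ⟦ atom p • ⊕ atom p ∘ ⟧)
axp-sound C p V r with locate C (atom p • ⊕ atom p ∘) V r
... | location G (bsq Γ Δ I M) eq (m ∷ [] , m' ∷ [] , tt) _ with extract m | extract m'
... | Γr , perm , _ | Δr , perm' , _ =
  conclude G eq (exchAt (toCtx G) (↭-sym perm) (↭-sym perm') (≋ᴮ-refl M) (axp (toCtx G) p Γr Δr I M))

∧•-sound : ∀ C A B → Sound (C ⟦ A • ⊕ B • ⟧) → Sound (C ⟦ (A ∧ B) • ⟧)
∧•-sound C A B ih V r with locate C ((A ∧ B) •) V r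
... | location G N@(bsq Γ Δ I M) eq (c ∷ [] , [] , tt) corr with c
... | inj₂ (a , b) = reuse ih eq corr (a ∷ b ∷ [] , [] , tt)
... | inj₁ m with extract m
... | Γr , perm , f =
  conclude G eq (exchAt (toCtx G) (↭-sym perm) ↭-refl (≋ᴮ-refl M)
    (∧L (toCtx G) A B Γr Δ I M (sound-at ih corr N' N≼N' (a ∷ b ∷ [] , [] , tt))))
  where
  N' : BSeq
  N' = bsq (A ∷ B ∷ Γr) Δ I M
  a : CoveredL N' A
  a = ∈⇒coveredL N' (here refl)
  b : CoveredL N' B
  b = ∈⇒coveredL N' (there (here refl))
  N≼N' : N ≼ N'
  N≼N' = ≼-node (coveredL-replace N' f (λ m → there (there m)) (inj₂ (a , b))) (∈⇒coveredR N') ≼*-refl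

∧∘-sound : ∀ C A B → Sound (C ⟦ A ∘ ⟧) → Sound (C ⟦ B ∘ ⟧) → Sound (C ⟦ (A ∧ B) ∘ ⟧)
∧∘-sound C A B ihA ihB V r with locate C ((A ∧ B) ∘) V r
... | location G N@(bsq Γ Δ I M) eq ([] , c ∷ [] , tt) corr with c
... | inj₂ (inj₁ a) = reuse ihA eq corr ([] , a ∷ [] , tt)
... | inj₂ (inj₂ b) = reuse ihB eq corr ([] , b ∷ [] , tt)
... | inj₁ m with extract m
... | Δr , perm , f =
  conclude G eq (exchAt (toCtx G) ↭-refl (↭-sym perm) (≋ᴮ-refl M)
    (∧R (toCtx G) A B Γ Δr I M (sound-at ihA corr Nᴬ N≼Nᴬ ([] , a ∷ [] , tt))
                               (sound-at ihB corr Nᴮ N≼Nᴮ ([] , b ∷ [] , tt))))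
  where
  Nᴬ : BSeq
  Nᴬ = bsq Γ (A ∷ Δr) I M
  Nᴮ : BSeq
  Nᴮ = bsq Γ (B ∷ Δr) I M
  a : CoveredR Nᴬ A
  a = ∈⇒coveredR Nᴬ (here refl)
  b : CoveredR Nᴮ B
  b = ∈⇒coveredR Nᴮ (here refl)
  N≼Nᴬ : N ≼ Nᴬ
  N≼Nᴬ = ≼-node (∈⇒coveredL Nᴬ) (coveredR-replace Nᴬ f there (inj₂ (inj₁ a))) ≼*-refl
  N≼Nᴮ : N ≼ Nᴮ
  N≼Nᴮ = ≼-node (∈⇒coveredL Nᴮ) (coveredR-replace Nᴮ f there (inj₂ (inj₂ b))) ≼*-refl

∨•-sound : ∀ C A B → Sound (C ⟦ A • ⟧) → Sound (C ⟦ B • ⟧) → Sound (C ⟦ (A ∨ B) • ⟧)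
∨•-sound C A B ihA ihB V r with locate C ((A ∨ B) •) V r
... | location G N@(bsq Γ Δ I M) eq (c ∷ [] , [] , tt) corr with c
... | inj₂ (inj₁ a) = reuse ihA eq corr (a ∷ [] , [] , tt)
... | inj₂ (inj₂ b) = reuse ihB eq corr (b ∷ [] , [] , tt)
... | inj₁ m with extract m
... | Γr , perm , f =
  conclude G eq (exchAt (toCtx G) (↭-sym perm) ↭-refl (≋ᴮ-refl M)
    (∨L (toCtx G) A B Γr Δ I M (sound-at ihA corr Nᴬ N≼Nᴬ (a ∷ [] , [] , tt))
                               (sound-at ihB corr Nᴮ N≼Nᴮ (b ∷ [] , [] , tt))))
  where
  Nᴬ : BSeq
  Nᴬ = bsq (A ∷ Γr) Δ I M
  Nᴮ : BSeq
  Nᴮ = bsq (B ∷ Γr) Δ I M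
  a : CoveredL Nᴬ A
  a = ∈⇒coveredL Nᴬ (here refl)
  b : CoveredL Nᴮ B
  b = ∈⇒coveredL Nᴮ (here refl)
  N≼Nᴬ : N ≼ Nᴬ
  N≼Nᴬ = ≼-node (coveredL-replace Nᴬ f there (inj₂ (inj₁ a))) (∈⇒coveredR Nᴬ) ≼*-refl
  N≼Nᴮ : N ≼ Nᴮ
  N≼Nᴮ = ≼-node (coveredL-replace Nᴮ f there (inj₂ (inj₂ b))) (∈⇒coveredR Nᴮ) ≼*-refl

∨∘-sound : ∀ C A B → Sound (C ⟦ A ∘ ⊕ B ∘ ⟧) → Sound (C ⟦ (A ∨ B) ∘ ⟧)
∨∘-sound C A B ih V r with locate C ((A ∨ B) ∘) V r
... | location G N@(bsq Γ Δ I M) eq ([] , c ∷ [] , tt) corr with c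
... | inj₂ (a , b) = reuse ih eq corr ([] , a ∷ b ∷ [] , tt)
... | inj₁ m with extract m
... | Δr , perm , f =
  conclude G eq (exchAt (toCtx G) ↭-refl (↭-sym perm) (≋ᴮ-refl M)
    (∨R (toCtx G) A B Γ Δr I M (sound-at ih corr N' N≼N' ([] , a ∷ b ∷ [] , tt))))
  where
  N' : BSeq
  N' = bsq Γ (A ∷ B ∷ Δr) I M
  a : CoveredR N' A
  a = ∈⇒coveredR N' (here refl)
  b : CoveredR N' B
  b = ∈⇒coveredR N' (there (here refl))
  N≼N' : N ≼ N'
  N≼N' = ≼-node (∈⇒coveredL N') (coveredR-replace N' f (λ m → there (there m)) (inj₂ (a , b))) ≼*-refl

⊃•-sound : ∀ C A B → Sound (C ⟦ A ∘ ⟧) → Sound (C ⟦ B • ⟧) → Sound (C ⟦ (A ⊃ B) • ⟧)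
⊃•-sound C A B ihA ihB V r with locate C ((A ⊃ B) •) V r
... | location G N@(bsq Γ Δ I M) eq (c ∷ [] , [] , tt) corr with c
... | inj₂ b = reuse ihB eq corr (b ∷ [] , [] , tt)
... | inj₁ m with extract m
... | Γr , perm , f =
  conclude G eq (exchAt (toCtx G) (↭-sym perm) ↭-refl (≋ᴮ-refl M)
    (⊃L (toCtx G) A B Γr Δ I M (sound-at ihA corr Nᴬ N≼Nᴬ ([] , ∈⇒coveredR Nᴬ (here refl) ∷ [] , tt))
                               (sound-at ihB corr Nᴮ N≼Nᴮ (b ∷ [] , [] , tt))))
  where
  Nᴬ : BSeq
  Nᴬ = bsq (A ⊃ B ∷ Γr) (A ∷ Δ) I M
  Nᴮ : BSeq
  Nᴮ = bsq (B ∷ Γr) Δ I M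
  b : CoveredL Nᴮ B
  b = ∈⇒coveredL Nᴮ (here refl)
  N≼Nᴬ : N ≼ Nᴬ
  N≼Nᴬ = ≼-node (coveredL-replace Nᴬ f there (∈⇒coveredL Nᴬ (here refl)))
                (λ m → ∈⇒coveredR Nᴬ (there m)) ≼*-refl
  N≼Nᴮ : N ≼ Nᴮ
  N≼Nᴮ = ≼-node (coveredL-replace Nᴮ f there (inj₂ b)) (∈⇒coveredR Nᴮ) ≼*-refl

-- A proof of the carried block can be placed at the root as an implication
-- block and moved back down to the hole.
sound-inImp : ∀ {C Π G N} → Sound ((C ↓) ⟦ Π ⟧) → RealisedCtx C G N →
              ∀ N' X → star N ≼ star N' → Π ⊑ X → CIK (toCtx G ⟪ addImp X N' ⟫)
sound-inImp {Π = Π} {G} ih c N' X N≼N' rΠ =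
  uncarry G top N' X (CIK-inImp (ih _ (⊑-carried N' X Π c N≼N' rΠ)) (carriedBody G N' X))

⊃∘-sound : ∀ C A B → Sound ((C ↓) ⟦ A • ⊕ B ∘ ⟧) → Sound (C ⟦ (A ⊃ B) ∘ ⟧)
⊃∘-sound C A B ih V r with locate C ((A ⊃ B) ∘) V r
... | location G (bsq Γ Δ I M) eq ([] , m ∷ [] , tt) corr with extract m
... | Δr , perm , _ =
  conclude G eq (exchAt (toCtx G) ↭-refl (↭-sym perm) (≋ᴮ-refl M)
    (⊃R (toCtx G) A B Γ Δr I M (sound-inImp ih corr (bsq Γ Δr I M) X ≼-refl rΠ)))
  where
  X : BSeq
  X = bsq [ A ] [ B ] [] []
  rΠ : A • ⊕ B ∘ ⊑ X
  rΠ = ∈⇒coveredL X (here refl) ∷ [] , ∈⇒coveredR X (here refl) ∷ [] , tt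

□∘-sound : ∀ C A → Sound ((C ↓) ⟦ blk (A ∘) ⟧) → Sound (C ⟦ □ A ∘ ⟧)
□∘-sound C A ih V r with locate C (□ A ∘) V r
... | location G (bsq Γ Δ I M) eq ([] , m ∷ [] , tt) corr with extract m
... | Δr , perm , _ =
  conclude G eq (exchAt (toCtx G) ↭-refl (↭-sym perm) (≋ᴮ-refl M)
    (□R (toCtx G) A Γ Δr I M (sound-inImp ih corr (bsq Γ Δr I M) (bsq [] [] [] [ Y ]) ≼-refl rΠ)))
  where
  Y : BSeq
  Y = bsq [] [ A ] [] []
  rΠ : blk (A ∘) ⊑ bsq [] [] [] [ Y ]
  rΠ = [] , [] , here ([] , ∈⇒coveredR Y (here refl) ∷ [] , tt) , tt

□•-sound : ∀ C A Θ → Sound (C ⟦ blk (Θ ⊕ A •) ⟧) → Sound (C ⟦ □ A • ⊕ blk Θ ⟧)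
□•-sound C A Θ ih V r with locate C (□ A • ⊕ blk Θ) V r
... | location G N@(bsq Γ Δ I M) eq (m ∷ [] , [] , a , tt) corr with extract m | any-split a
... | Γr , perm , f | M₁ , T , M₂ , refl , rT =
  conclude G eq (exchAt (toCtx G) (↭-sym perm) ↭-refl (≋ᴮ-fromFront T M₁ M₂)
    (□L (toCtx G) A Γr Δ I (M₁ ++ M₂) T (sound-at ih corr N' N≼N' ([] , [] , here rT' , tt))))
  where
  N' : BSeq
  N' = bsq (□ A ∷ Γr) Δ I (addL [ A ] T ∷ M₁ ++ M₂)
  rT' : Θ ⊕ A • ⊑ addL [ A ] T
  rT' = ⊑-⊕⁺ Θ (A •) (≼-addL A T Θ rT) (addL-covers A T ∷ [] , [] , tt)
  N≼N' : N ≼ N'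
  N≼N' = ≼-node (coveredL-replace N' f there (∈⇒coveredL N' (here refl))) (∈⇒coveredR N')
                (≼*-toFront M₁ (≼-addL A T))

◇∘-sound : ∀ C A Θ → Sound (C ⟦ blk (Θ ⊕ A ∘) ⟧) → Sound (C ⟦ ◇ A ∘ ⊕ blk Θ ⟧)
◇∘-sound C A Θ ih V r with locate C (◇ A ∘ ⊕ blk Θ) V r
... | location G N@(bsq Γ Δ I M) eq ([] , m ∷ [] , a , tt) corr with extract m | any-split a
... | Δr , perm , f | M₁ , T , M₂ , refl , rT =
  conclude G eq (exchAt (toCtx G) ↭-refl (↭-sym perm) (≋ᴮ-fromFront T M₁ M₂)
    (◇R (toCtx G) A Γ Δr I (M₁ ++ M₂) T (sound-at ih corr N' N≼N' ([] , [] , here rT' , tt))))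
  where
  N' : BSeq
  N' = bsq Γ (◇ A ∷ Δr) I (addR A T ∷ M₁ ++ M₂)
  rT' : Θ ⊕ A ∘ ⊑ addR A T
  rT' = ⊑-⊕⁺ Θ (A ∘) (≼-addR A T Θ rT) ([] , addR-covers A T ∷ [] , tt)
  N≼N' : N ≼ N'
  N≼N' = ≼-node (∈⇒coveredL N') (coveredR-replace N' f there (∈⇒coveredR N' (here refl)))
                (≼*-toFront M₁ (≼-addR A T))

◇•-sound : ∀ C A → Sound (C ⟦ blk (A •) ⟧) → Sound (C ⟦ ◇ A • ⟧)
◇•-sound C A ih V r with locate C (◇ A •) V r
... | location G N@(bsq Γ Δ I M) eq (c ∷ [] , [] , tt) corr with c
... | inj₂ a = reuse ih eq corr ([] , [] , Any.map (λ c → c ∷ [] , [] , tt) a , tt)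
... | inj₁ m with extract m
... | Γr , perm , f =
  conclude G eq (exchAt (toCtx G) (↭-sym perm) ↭-refl (≋ᴮ-refl M)
    (◇L (toCtx G) A Γr Δ I M (sound-at ih corr N' N≼N' ([] , [] , here (a ∷ [] , [] , tt) , tt))))
  where
  Y : BSeq
  Y = bsq [ A ] [] [] []
  N' : BSeq
  N' = bsq Γr Δ I (Y ∷ M)
  a : CoveredL Y A
  a = ∈⇒coveredL Y (here refl)
  N≼N' : N ≼ N'
  N≼N' = ≼-node (coveredL-replace N' f (λ m → m) (inj₂ (here a))) (∈⇒coveredR N')
                (λ m → _ , there m , ≼-refl)

cont•-sound : ∀ C A → Sound (C ⟦ A • ⊕ A • ⟧) → Sound (C ⟦ A • ⟧)
cont•-sound C A ih V r with locate C (A •) V r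
... | location G N eq (c ∷ [] , [] , tt) corr = reuse ih eq corr (c ∷ c ∷ [] , [] , tt)

cont∘-sound : ∀ C A → Sound (C ⟦ A ∘ ⊕ A ∘ ⟧) → Sound (C ⟦ A ∘ ⟧)
cont∘-sound C A ih V r with locate C (A ∘) V r
... | location G N eq ([] , c ∷ [] , tt) corr = reuse ih eq corr ([] , c ∷ c ∷ [] , tt)

NIKm⇒sound : ∀ {S} → NIKm S → Sound S
NIKm⇒sound (exch e p) V r     = NIKm⇒sound p V (≈ᴾ-⊑ e r)
NIKm⇒sound (ax⊥ C)            = ax⊥-sound C
NIKm⇒sound (axp C p)          = axp-sound C p
NIKm⇒sound (∧• C A B p)       = ∧•-sound C A B (NIKm⇒sound p)
NIKm⇒sound (∧∘ C A B p q)     = ∧∘-sound C A B (NIKm⇒sound p) (NIKm⇒sound q)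
NIKm⇒sound (∨• C A B p q)     = ∨•-sound C A B (NIKm⇒sound p) (NIKm⇒sound q)
NIKm⇒sound (∨∘ C A B p)       = ∨∘-sound C A B (NIKm⇒sound p)
NIKm⇒sound (⊃• C A B p q)     = ⊃•-sound C A B (NIKm⇒sound p) (NIKm⇒sound q)
NIKm⇒sound (⊃∘ C A B p)       = ⊃∘-sound C A B (NIKm⇒sound p)
NIKm⇒sound (□• C A Θ p)       = □•-sound C A Θ (NIKm⇒sound p)
NIKm⇒sound (□∘ C A p)         = □∘-sound C A (NIKm⇒sound p)
NIKm⇒sound (◇• C A p)         = ◇•-sound C A (NIKm⇒sound p)
NIKm⇒sound (◇∘ C A Θ p)       = ◇∘-sound C A Θ (NIKm⇒sound p)
NIKm⇒sound (cont• C A p)      = cont•-sound C A (NIKm⇒sound p)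
NIKm⇒sound (cont∘ C A p)      = cont∘-sound C A (NIKm⇒sound p)

mutual
  ⊑-fl : ∀ S → S ⊑ fl S
  ⊑-fl (psq I O B) = All.tabulate (∈⇒coveredL (fl (psq I O B))) ,
                     All.tabulate (∈⇒coveredR (fl (psq I O B))) ,
                     ⊑*-flL B (λ m → m)

  ⊑*-flL : ∀ B {M} → (∀ {T} → T ∈ flL B → T ∈ M) → B ⊑* M
  ⊑*-flL []      flB⊆M = tt
  ⊑*-flL (S ∷ B) flB⊆M = lose (flB⊆M (here refl)) (⊑-fl S) , ⊑*-flL B (λ m → flB⊆M (there m))

theorem6 : (Σ : PSeq) → NIKm Σ → CIK (fl Σ)
theorem6 S p = NIKm⇒sound p (fl S) (⊑-fl S)
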